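{- Let $p$ be an odd prime, $r\ge2$, and let $\theta\in\overline{\mathbb{F}}_2$ satisfy $\theta^p=1$. Then for every $0\le l<p$, $D_l(\theta)=0$ if $\theta=1$, and $D_l(\theta)=1$ otherwise.
   Context: Let $\varphi$ be Euler's totient function. For $r\ge1$, $Q_r(u)$ is the unique integer with $0\le Q_r(u)<p^r$ and $Q_r(u)\equiv \frac{u^{\varphi(p^r)}-1}{p^r}\pmod{p^r}$ if $\gcd(u,p)=1$, and $Q_r(u)=0$ if $p\mid u$. Define $H_0=Q_1$ and for $r\ge2$ let $H_{r-1}(u)\in\{0,\dots,p-1\}$ with $H_{r-1}(u)\equiv (Q_r(u)-Q_{r-1}(u))/p^{r-1}\pmod p$. For $0\le l<p$, $D_l=\{u:0\le u<p^{r+1},\ \gcd(u,p)=1,\ H_{r-1}(u)=l\}$ and $D_l(X)=\sum_{u\in D_l}X^u\in\mathbb{F}_2[X]$. $\overline{\mathbb{F}}_2$ is an algebraic closure of $\mathbb{F}_2$. -}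

module Defs where

open import Level using (Level; _⊔_) renaming (suc to lsuc)
open import Data.Nat using (ℕ; zero; suc; _∸_; _^_; _≟_)
import Data.Nat as ℕ
open import Data.Nat.DivMod using (_/_; _%_)
open import Data.Nat.GCD using (gcd)
open import Data.Integer as ℤ using (ℤ; +_; _/ℕ_; _%ℕ_)
open import Data.List using (List; upTo; map; filter; length; foldr)
open import Data.Bool using (if_then_else_; _∧_)
open import Data.Product using (∃)
open import Relation.Nullary using (¬_; does)
open import Algebra.Bundles using (CommutativeRing; Semiring)

record Char2Field (c ℓ : Level) : Set (lsuc (c ⊔ ℓ)) where
  field
    commutativeRing : CommutativeRing c ℓ
  open CommutativeRing commutativeRing public
  field
    nontrivial : ¬ (1# ≈ 0#)
    inverse    : ∀ x → ¬ (x ≈ 0#) → ∃ λ y → x * y ≈ 1#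
    char2      : 1# + 1# ≈ 0#

pow : ∀ {c ℓ} (F : Char2Field c ℓ) → Char2Field.Carrier F → ℕ → Char2Field.Carrier F
pow F = RS._^_ (Semiring.rawSemiring (Char2Field.semiring F))
  where import Algebra.Definitions.RawSemiring as RS

-- Division / remainder on ℕ and ℤ by a natural divisor (divisor 0 never
-- occurs in our uses since p is prime; it is sent to 0 only for totality).
divN : ℕ → ℕ → ℕ
divN a zero    = 0
divN a (suc d) = a / suc d

modN : ℕ → ℕ → ℕ
modN a zero    = 0
modN a (suc d) = a % suc d

divZ : ℤ → ℕ → ℤ
divZ a zero    = + 0
divZ a (suc d) = a /ℕ suc d

modZ : ℤ → ℕ → ℕ
modZ a zero    = 0
modZ a (suc d) = a %ℕ suc d

φ : ℕ → ℕ
φ n = length (filter (λ k → gcd k n ≟ 1) (map suc (upTo n)))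

-- Q_r(u) for the prime p (r ≥ 1):
--   Q_r(u) = ((u^{φ(p^r)} - 1) / p^r) mod p^r   if gcd(u,p) = 1,   0 otherwise.
-- (For gcd(u,p)=1, u ≥ 1 so u^{φ(p^r)} ≥ 1 and p^r divides u^{φ(p^r)} - 1 by
--  Euler's theorem, so the division is exact.)
Q : (p r u : ℕ) → ℕ
Q p r u = if does (gcd u p ≟ 1)
            then modN (divN (u ^ φ (p ^ r) ∸ 1) (p ^ r)) (p ^ r)
            else 0

-- H_{r-1}(u) for r ≥ 2: the residue in {0,…,p-1} of (Q_r(u) - Q_{r-1}(u)) / p^{r-1}.
-- Here the argument r is the paper's r (so this is H_{r-1}).
H : (p r u : ℕ) → ℕ
H p r u = modZ (divZ (+ Q p r u ℤ.- + Q p (r ∸ 1) u) (p ^ (r ∸ 1))) p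

Dl : ∀ {c ℓ} (F : Char2Field c ℓ) (p r l : ℕ) → Char2Field.Carrier F → Char2Field.Carrier F
Dl F p r l θ =
  foldr (λ u acc → if does (gcd u p ≟ 1) ∧ does (H p r u ≟ l)
                     then pow F θ u + acc
                     else acc)
        0# (upTo (p ^ suc r))
  where open Char2Field F

-- Write u < p^(r+1) as u = i·p^r + j with i < p and j < p^r; since θ^p = 1, θ^u = θ^j.
-- For p ∤ j, expanding (i·p^r + j)^φ(p^r) and (i·p^r + j)^φ(p^(r-1)) to first order shows
-- that Q_(r-1) does not move while Q_r moves by p^(r-1)·i·(p-1)·j^(φ(p^r)-1) modulo p^r, so
-- H_(r-1)(i·p^r + j) ≡ H_(r-1)(j) + i·(p-1)·j^(φ(p^r)-1) (mod p): affine in i with slope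
-- prime to p, hence equal to l for exactly one i. So D_l(θ) = Σ_{j<p^r, p∤j} θ^j, which by
-- p-periodicity is p^(r-1) copies of Σ_{0<j<p} θ^j; p^(r-1) is odd and the characteristic
-- is 2, so 1 + D_l(θ) = Σ_{j<p} θ^j. That sum is p·1 = 1 for θ = 1 and 0 for every other
-- p-th root of unity.

module Submission where

open import Defs
open import Algebra.Bundles using (CommutativeMonoid; Semiring)
open import Data.Nat using (ℕ; zero; suc; _≤_; _<_; s≤s)
open import Data.Nat.Primality using (Prime)
open import Data.Product using (_×_; _,_)
open import Relation.Nullary using (¬_)
open import Relation.Binary.PropositionalEquality using (_≢_)

module FiniteSum {c ℓ} (M : CommutativeMonoid c ℓ) where
  open import Data.Bool using (Bool; true; false; if_then_else_)
  open import Data.Bool.Properties using (¬-not)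
  open import Data.List using (foldr; applyUpTo)
  open import Data.Nat using (_+_; _*_; z≤n)
  import Data.Nat.Properties as ℕ
  open import Function using (_∘_; const)
  import Relation.Binary.PropositionalEquality as ≡
  open ≡ using (_≡_; cong)
  open CommutativeMonoid M
  open import Algebra.Properties.CommutativeSemigroup commutativeSemigroup using (interchange)
  open import Relation.Binary.Reasoning.Setoid setoid

  ∑ : ℕ → (ℕ → Carrier) → Carrier
  ∑ zero    f = ε
  ∑ (suc n) f = f 0 ∙ ∑ n (f ∘ suc)

  ∑-cong< : ∀ n {f g : ℕ → Carrier} → (∀ i → i < n → f i ≈ g i) → ∑ n f ≈ ∑ n g
  ∑-cong< zero    f≈g = refl
  ∑-cong< (suc n) f≈g = ∙-cong (f≈g 0 (s≤s z≤n)) (∑-cong< n (λ i i<n → f≈g (suc i) (s≤s i<n)))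

  ∑-cong : ∀ n {f g : ℕ → Carrier} → (∀ i → f i ≈ g i) → ∑ n f ≈ ∑ n g
  ∑-cong n f≈g = ∑-cong< n (λ i _ → f≈g i)

  ∑-length : ∀ {m n} (f : ℕ → Carrier) → m ≡ n → ∑ m f ≈ ∑ n f
  ∑-length f ≡.refl = refl

  ∑-ε : ∀ n → ∑ n (const ε) ≈ ε
  ∑-ε zero    = refl
  ∑-ε (suc n) = trans (identityˡ _) (∑-ε n)

  ∑-distrib : ∀ n (f g : ℕ → Carrier) → ∑ n (λ i → f i ∙ g i) ≈ ∑ n f ∙ ∑ n g
  ∑-distrib zero    f g = sym (identityˡ ε)
  ∑-distrib (suc n) f g = trans (∙-congˡ (∑-distrib n (f ∘ suc) (g ∘ suc))) (interchange _ _ _ _)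

  ∑-+ : ∀ m n (f : ℕ → Carrier) → ∑ (m + n) f ≈ ∑ m f ∙ ∑ n (f ∘ (m +_))
  ∑-+ zero    n f = sym (identityˡ _)
  ∑-+ (suc m) n f = trans (∙-congˡ (∑-+ m n (f ∘ suc))) (sym (assoc _ _ _))

  ∑-* : ∀ m n (f : ℕ → Carrier) → ∑ (m * n) f ≈ ∑ m (λ i → ∑ n (λ j → f (i * n + j)))
  ∑-* zero    n f = refl
  ∑-* (suc m) n f = begin
    ∑ (n + m * n) f                                           ≈⟨ ∑-+ n (m * n) f ⟩
    ∑ n f ∙ ∑ (m * n) (f ∘ (n +_))                            ≈⟨ ∙-congˡ (∑-* m n _) ⟩
    ∑ n f ∙ ∑ m (λ i → ∑ n (λ j → f (n + (i * n + j))))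
      ≈⟨ ∙-congˡ (∑-cong m (λ i → ∑-cong n (λ j → reflexive (cong f (≡.sym (ℕ.+-assoc n (i * n) j)))))) ⟩
    ∑ n f ∙ ∑ m (λ i → ∑ n (λ j → f (suc i * n + j)))          ∎

  ∑-comm : ∀ m n (f : ℕ → ℕ → Carrier) → ∑ m (λ i → ∑ n (f i)) ≈ ∑ n (λ j → ∑ m (λ i → f i j))
  ∑-comm zero    n f = sym (∑-ε n)
  ∑-comm (suc m) n f = begin
    ∑ n (f 0) ∙ ∑ m (λ i → ∑ n (f (suc i)))    ≈⟨ ∙-congˡ (∑-comm m n (f ∘ suc)) ⟩
    ∑ n (f 0) ∙ ∑ n (λ j → ∑ m (λ i → f (suc i) j)) ≈⟨ sym (∑-distrib n _ _) ⟩
    ∑ n (λ j → ∑ (suc m) (λ i → f i j))          ∎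

  indicator : Bool → Carrier → Carrier
  indicator β x = if β then x else ε

  indicator-cong : ∀ {β β′ x y} → β ≡ β′ → x ≈ y → indicator β x ≈ indicator β′ y
  indicator-cong {true}  ≡.refl x≈y = x≈y
  indicator-cong {false} ≡.refl x≈y = refl

  ∑-indicator-none : ∀ n (b : ℕ → Bool) (f : ℕ → Carrier) → (∀ i → i < n → b i ≡ false) →
                     ∑ n (λ i → indicator (b i) (f i)) ≈ ε
  ∑-indicator-none n b f none = trans (∑-cong< n (λ i i<n → indicator-cong (none i i<n) refl)) (∑-ε n)

  ∑-indicator-unique : ∀ n (b : ℕ → Bool) x {i₀} → i₀ < n → b i₀ ≡ true →
                       (∀ i → i < n → b i ≡ true → i ≡ i₀) →
                       ∑ n (λ i → indicator (b i) x) ≈ x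
  ∑-indicator-unique (suc n) b x {zero} _ on unique = begin
    indicator (b 0) x ∙ ∑ n (λ i → indicator (b (suc i)) x)
      ≈⟨ ∙-cong (indicator-cong on refl) (∑-indicator-none n (b ∘ suc) (const x) off) ⟩
    x ∙ ε ≈⟨ identityʳ x ⟩
    x     ∎
    where
    off : ∀ i → i < n → b (suc i) ≡ false
    off i i<n = ¬-not (λ on′ → ℕ.1+n≢0 (unique (suc i) (s≤s i<n) on′))
  ∑-indicator-unique (suc n) b x {suc i₀} (s≤s i₀<n) on unique = begin
    indicator (b 0) x ∙ ∑ n (λ i → indicator (b (suc i)) x)
      ≈⟨ ∙-cong (indicator-cong off refl)
                (∑-indicator-unique n (b ∘ suc) x i₀<n on (λ i i<n on′ → ℕ.suc-injective (unique (suc i) (s≤s i<n) on′))) ⟩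
    ε ∙ x ≈⟨ identityˡ x ⟩
    x     ∎
    where
    off : b 0 ≡ false
    off = ¬-not (λ on′ → ℕ.0≢1+n (unique 0 (s≤s z≤n) on′))

  foldr-select≈∑ : ∀ (b : ℕ → Bool) (f : ℕ → Carrier) (g : ℕ → ℕ) n →
                   foldr (λ u acc → if b u then f u ∙ acc else acc) ε (applyUpTo g n)
                   ≈ ∑ n (λ i → indicator (b (g i)) (f (g i)))
  foldr-select≈∑ b f g zero = refl
  foldr-select≈∑ b f g (suc n) with b (g 0)
  ... | true  = ∙-congˡ (foldr-select≈∑ b f (g ∘ suc) n)
  ... | false = trans (foldr-select≈∑ b f (g ∘ suc) n) (sym (identityˡ _))

module NatFacts where
  open import Level using (0ℓ)
  open import Data.Bool using (true; false)
  open import Data.List using (length; filter; map; applyUpTo)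
  open import Data.Nat using (_+_; _*_; _^_; _∸_; _%_)
  import Data.Nat.Properties as ℕ
  open import Data.Nat.DivMod using (%-distribˡ-*)
  open import Data.Nat.Divisibility using (_∣_; ∣m∣n⇒∣m+n; ∣m+n∣m⇒∣n; n∣m*n)
  import Data.Nat.Tactic.RingSolver as ℕ-Solver
  open import Data.Product using (∃)
  open import Function using (_∘_; _⇔_; mk⇔)
  open import Relation.Nullary using (Dec; yes; does)
  open import Relation.Unary using (Pred; Decidable)
  import Relation.Binary.PropositionalEquality as ≡
  open ≡ using (_≡_; refl; trans; cong; cong₂)

  ∣[k*d+u]⇔∣u : ∀ k d u → d ∣ k * d + u ⇔ d ∣ u
  ∣[k*d+u]⇔∣u k d u = mk⇔ (λ d∣kd+u → ∣m+n∣m⇒∣n d∣kd+u (n∣m*n k)) (∣m∣n⇒∣m+n (n∣m*n k))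

  odd-^ : ∀ {m} → m % 2 ≡ 1 → ∀ k → m ^ k % 2 ≡ 1
  odd-^ odd zero = refl
  odd-^ {m} odd (suc k) = trans (%-distribˡ-* m (m ^ k) 2) (cong₂ (λ x y → (x * y) % 2) odd (odd-^ odd k))

  binomial-truncated : ∀ x u N → ∃ λ R → (x + u) ^ N ≡ u ^ N + N * x * u ^ (N ∸ 1) + x * x * R
  binomial-truncated x u zero       = 0 , base x
    where
    base : ∀ x → 1 ≡ 1 + 0 * x * 1 + x * x * 0
    base = ℕ-Solver.solve-∀
  binomial-truncated x u (suc zero) = 0 , base x u
    where
    base : ∀ x u → (x + u) * 1 ≡ u * 1 + 1 * x * 1 + x * x * 0
    base = ℕ-Solver.solve-∀
  binomial-truncated x u (suc (suc N)) with binomial-truncated x u (suc N)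
  ... | R , eq = suc N * u ^ N + (x + u) * R , trans (cong ((x + u) *_) eq) (step x u R N (u ^ N))
    where
    step : ∀ x u R N U → (x + u) * (u * U + suc N * x * U + x * x * R)
           ≡ u * (u * U) + suc (suc N) * x * (u * U) + x * x * (suc N * U + (x + u) * R)
    step = ℕ-Solver.solve-∀

  module ℕ∑ = FiniteSum ℕ.+-0-commutativeMonoid
  open ℕ∑ using (∑; indicator)

  length-filter≡∑ : ∀ {P : Pred ℕ 0ℓ} (P? : Decidable P) (g : ℕ → ℕ) n →
                    length (filter P? (map suc (applyUpTo g n))) ≡ ∑ n (λ i → indicator (does (P? (suc (g i)))) 1)
  length-filter≡∑ P? g zero = refl
  length-filter≡∑ P? g (suc n) with does (P? (suc (g 0)))
  ... | true  = cong suc (length-filter≡∑ P? (g ∘ suc) n)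
  ... | false = length-filter≡∑ P? (g ∘ suc) n

  ∑-const : ∀ n c → ∑ n (λ _ → c) ≡ n * c
  ∑-const zero    c = refl
  ∑-const (suc n) c = cong (c +_) (∑-const n c)

  does≡true⇒ : ∀ {a} {A : Set a} (a? : Dec A) → does a? ≡ true → A
  does≡true⇒ (yes a) _ = a

module IntegerDivision where
  open import Data.Nat using (_+_; _*_; _∸_; _%_; _/_; NonZero)
  import Data.Nat.Properties as ℕ
  open import Data.Nat.DivMod using (m≡m%n+[m/n]*n; [m+kn]%n≡m%n; +-distrib-/-∣ʳ; m*n/n≡m)
  open import Data.Nat.Divisibility using (divides)
  open import Data.Integer as ℤ using (ℤ; +_; +[1+_]; -[1+_]; _/ℕ_; _%ℕ_; 0ℤ)
  import Data.Integer.Properties as ℤ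
  open import Data.Integer.DivMod using (a≡a%ℕn+[a/ℕn]*n; n%ℕd<d)
  import Data.Integer.Tactic.RingSolver as ℤ-Solver
  import Data.Nat.Tactic.RingSolver as ℕ-Solver
  open import Data.Product using (proj₁; proj₂)
  open import Data.Empty using (⊥; ⊥-elim)
  import Relation.Binary.PropositionalEquality as ≡
  open ≡ using (_≡_; refl; sym; trans; cong)

  r≢r′+[1+n]*d : ∀ {r r′ d} n → r < d → + r ≡ + r′ ℤ.+ +[1+ n ] ℤ.* + d → ⊥
  r≢r′+[1+n]*d {r} {r′} {d} n r<d eq = ℕ.<⇒≱ r<d (begin
    d                   ≤⟨ ℕ.m≤m+n d (n * d) ⟩
    suc n * d           ≤⟨ ℕ.m≤n+m (suc n * d) r′ ⟩
    r′ + suc n * d      ≡⟨ ℤ.+-injective (trans (ℤ.pos-+ r′ (suc n * d)) (trans (cong (λ z → + r′ ℤ.+ z) (ℤ.pos-* (suc n) d)) (sym eq))) ⟩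
    r                   ∎)
    where open ℕ.≤-Reasoning

  r≡r′+k*d⇒k≡0 : ∀ {r r′ d} k → r < d → r′ < d → + r ≡ + r′ ℤ.+ k ℤ.* + d → k ≡ 0ℤ
  r≡r′+k*d⇒k≡0 (+ zero)   _   _    _  = refl
  r≡r′+k*d⇒k≡0 +[1+ n ]   r<d _    eq = ⊥-elim (r≢r′+[1+n]*d n r<d eq)
  r≡r′+k*d⇒k≡0 {r} {r′} {d} -[1+ n ] _ r′<d eq =
    ⊥-elim (r≢r′+[1+n]*d n r′<d (trans (cancel (+ r′) -[1+ n ] (+ d)) (cong (λ z → z ℤ.+ +[1+ n ] ℤ.* + d) (sym eq))))
    where
    cancel : ∀ a k e → a ≡ (a ℤ.+ k ℤ.* e) ℤ.+ (ℤ.- k) ℤ.* e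
    cancel = ℤ-Solver.solve-∀

  /ℕ-%ℕ-unique : ∀ z d .{{_ : NonZero d}} r t → r < d → z ≡ + r ℤ.+ t ℤ.* + d → z /ℕ d ≡ t × z %ℕ d ≡ r
  /ℕ-%ℕ-unique z d r t r<d eq = quotient , remainder
    where
    shifted : + r ≡ + (z %ℕ d) ℤ.+ (z /ℕ d ℤ.- t) ℤ.* + d
    shifted = trans (move (+ r) t (+ d)) (trans (cong (ℤ._- t ℤ.* + d) (trans (sym eq) (a≡a%ℕn+[a/ℕn]*n z d)))
                    (regroup (+ (z %ℕ d)) (z /ℕ d) (+ d) t))
      where
      move : ∀ a b c → a ≡ (a ℤ.+ b ℤ.* c) ℤ.- b ℤ.* c
      move = ℤ-Solver.solve-∀
      regroup : ∀ a b c e → (a ℤ.+ b ℤ.* c) ℤ.- e ℤ.* c ≡ a ℤ.+ (b ℤ.- e) ℤ.* c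
      regroup = ℤ-Solver.solve-∀
    difference : z /ℕ d ℤ.- t ≡ 0ℤ
    difference = r≡r′+k*d⇒k≡0 _ r<d (n%ℕd<d z d) shifted
    quotient : z /ℕ d ≡ t
    quotient = ℤ.i-j≡0⇒i≡j _ t difference
    remainder : z %ℕ d ≡ r
    remainder = sym (ℤ.+-injective (trans shifted (trans (cong (λ k → + (z %ℕ d) ℤ.+ k ℤ.* + d) difference) (ℤ.+-identityʳ _))))

  /ℕ-%ℕ-+-* : ∀ z d .{{_ : NonZero d}} w → (z ℤ.+ w ℤ.* + d) /ℕ d ≡ z /ℕ d ℤ.+ w × (z ℤ.+ w ℤ.* + d) %ℕ d ≡ z %ℕ d
  /ℕ-%ℕ-+-* z d w = /ℕ-%ℕ-unique (z ℤ.+ w ℤ.* + d) d (z %ℕ d) (z /ℕ d ℤ.+ w) (n%ℕd<d z d)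
    (trans (cong (ℤ._+ w ℤ.* + d) (a≡a%ℕn+[a/ℕn]*n z d)) (regroup (+ (z %ℕ d)) (z /ℕ d) w (+ d)))
    where
    regroup : ∀ a b c e → (a ℤ.+ b ℤ.* e) ℤ.+ c ℤ.* e ≡ a ℤ.+ (b ℤ.+ c) ℤ.* e
    regroup = ℤ-Solver.solve-∀

  divZ-+-* : ∀ z d .{{_ : NonZero d}} w → divZ (z ℤ.+ w ℤ.* + d) d ≡ divZ z d ℤ.+ w
  divZ-+-* z (suc d) w = proj₁ (/ℕ-%ℕ-+-* z (suc d) w)

  modZ-+-* : ∀ z d .{{_ : NonZero d}} w → modZ (z ℤ.+ w ℤ.* + d) d ≡ modZ z d
  modZ-+-* z (suc d) w = proj₂ (/ℕ-%ℕ-+-* z (suc d) w)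

  modZ-+ : ∀ z d .{{_ : NonZero d}} m → modZ (z ℤ.+ + m) d ≡ (modZ z d + m) % d
  modZ-+ z d@(suc _) m = begin
    (z ℤ.+ + m) %ℕ d                                     ≡⟨ cong (λ x → (x ℤ.+ + m) %ℕ d) (a≡a%ℕn+[a/ℕn]*n z d) ⟩
    (+ (z %ℕ d) ℤ.+ z /ℕ d ℤ.* + d ℤ.+ + m) %ℕ d         ≡⟨ cong (_%ℕ d) (regroup (+ (z %ℕ d)) (z /ℕ d) (+ m) (+ d)) ⟩
    (+ (z %ℕ d) ℤ.+ + m ℤ.+ z /ℕ d ℤ.* + d) %ℕ d         ≡⟨ modZ-+-* (+ (z %ℕ d) ℤ.+ + m) d (z /ℕ d) ⟩
    (+ (z %ℕ d) ℤ.+ + m) %ℕ d                            ≡⟨ cong (_%ℕ d) (sym (ℤ.pos-+ (z %ℕ d) m)) ⟩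
    (z %ℕ d + m) % d                                     ∎
    where
    open ≡.≡-Reasoning
    regroup : ∀ a b c e → (a ℤ.+ b ℤ.* e) ℤ.+ c ≡ (a ℤ.+ c) ℤ.+ b ℤ.* e
    regroup = ℤ-Solver.solve-∀

  modN-divN : ∀ a d .{{_ : NonZero d}} → a ≡ modN a d + divN a d * d
  modN-divN a (suc d) = m≡m%n+[m/n]*n a (suc d)

  divN-+-* : ∀ a d .{{_ : NonZero d}} w → divN (a + d * w) d ≡ divN a d + w
  divN-+-* a d@(suc _) w = trans (+-distrib-/-∣ʳ a (divides w (ℕ.*-comm d w)))
    (cong (λ x → a / d + x) (trans (cong (_/ d) (ℕ.*-comm d w)) (m*n/n≡m w d)))

  modN-+-* : ∀ a d .{{_ : NonZero d}} w → modN (a + d * w) d ≡ modN a d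
  modN-+-* a d@(suc _) w = trans (cong (λ x → (a + x) % d) (ℕ.*-comm d w)) ([m+kn]%n≡m%n a w d)

  divN-pred-+-* : ∀ v d .{{_ : NonZero d}} w → 1 ≤ v → divN (v + d * w ∸ 1) d ≡ divN (v ∸ 1) d + w
  divN-pred-+-* v d w 1≤v = trans (cong (λ x → divN x d) (ℕ.+-∸-comm (d * w) 1≤v)) (divN-+-* (v ∸ 1) d w)

  -- ⌊(a mod pq − b)/q⌋ mod p; H_(r-1)(u) is this with q = p^(r-1), a = (u^φ(p^r) − 1)/p^r, b = Q_(r-1)(u).
  digit : (p q b a : ℕ) → ℕ
  digit p q b a = modZ (divZ (+ modN a (p * q) ℤ.- + b) q) p

  digit-+-* : ∀ p q .{{_ : NonZero p}} .{{_ : NonZero q}} b a s → digit p q b (a + q * s) ≡ (digit p q b a + s) % p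
  digit-+-* p q b a s = begin
    modZ (divZ (X′ ℤ.- B) q) p                                 ≡⟨ cong (λ z → modZ (divZ z q) p) shifted ⟩
    modZ (divZ ((X ℤ.- B) ℤ.+ w ℤ.* + q) q) p                  ≡⟨ cong (λ z → modZ z p) (divZ-+-* (X ℤ.- B) q w) ⟩
    modZ (divZ (X ℤ.- B) q ℤ.+ w) p                            ≡⟨ cong (λ z → modZ z p) (regroup (divZ (X ℤ.- B) q) S T T′ (+ p)) ⟩
    modZ ((divZ (X ℤ.- B) q ℤ.+ S) ℤ.+ (T ℤ.- T′) ℤ.* + p) p   ≡⟨ modZ-+-* (divZ (X ℤ.- B) q ℤ.+ S) p (T ℤ.- T′) ⟩
    modZ (divZ (X ℤ.- B) q ℤ.+ + s) p                          ≡⟨ modZ-+ (divZ (X ℤ.- B) q) p s ⟩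
    (modZ (divZ (X ℤ.- B) q) p + s) % p                        ∎
    where
    open ≡.≡-Reasoning
    instance
      pq≢0 : NonZero (p * q)
      pq≢0 = ℕ.m*n≢0 p q
    lift : ∀ a → + a ≡ + modN a (p * q) ℤ.+ + divN a (p * q) ℤ.* (+ p ℤ.* + q)
    lift a = trans (cong +_ (modN-divN a (p * q)))
             (trans (ℤ.pos-+ (modN a (p * q)) _)
             (cong (λ z → + modN a (p * q) ℤ.+ z) (trans (ℤ.pos-* (divN a (p * q)) (p * q)) (cong (+ divN a (p * q) ℤ.*_) (ℤ.pos-* p q)))))
    X X′ B S T T′ w : ℤ
    X  = + modN a (p * q)
    X′ = + modN (a + q * s) (p * q)
    B  = + b
    S  = + s
    T  = + divN a (p * q)
    T′ = + divN (a + q * s) (p * q)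
    w  = S ℤ.+ (T ℤ.- T′) ℤ.* + p
    a+qs : + (a + q * s) ≡ + a ℤ.+ + q ℤ.* S
    a+qs = trans (ℤ.pos-+ a (q * s)) (cong (λ z → + a ℤ.+ z) (ℤ.pos-* q s))
    shifted : X′ ℤ.- B ≡ (X ℤ.- B) ℤ.+ w ℤ.* + q
    shifted = begin
      X′ ℤ.- B                                                        ≡⟨ isolate X′ T′ (+ p ℤ.* + q) B ⟩
      (X′ ℤ.+ T′ ℤ.* (+ p ℤ.* + q)) ℤ.- T′ ℤ.* (+ p ℤ.* + q) ℤ.- B   ≡⟨ cong (λ z → z ℤ.- T′ ℤ.* (+ p ℤ.* + q) ℤ.- B) (sym (trans (sym a+qs) (lift (a + q * s)))) ⟩
      (+ a ℤ.+ + q ℤ.* S) ℤ.- T′ ℤ.* (+ p ℤ.* + q) ℤ.- B              ≡⟨ cong (λ z → (z ℤ.+ + q ℤ.* S) ℤ.- T′ ℤ.* (+ p ℤ.* + q) ℤ.- B) (lift a) ⟩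
      (X ℤ.+ T ℤ.* (+ p ℤ.* + q) ℤ.+ + q ℤ.* S) ℤ.- T′ ℤ.* (+ p ℤ.* + q) ℤ.- B ≡⟨ collect X T T′ (+ p) (+ q) S B ⟩
      (X ℤ.- B) ℤ.+ w ℤ.* + q                                         ∎
      where
      isolate : ∀ x t m b → x ℤ.- b ≡ (x ℤ.+ t ℤ.* m) ℤ.- t ℤ.* m ℤ.- b
      isolate = ℤ-Solver.solve-∀
      collect : ∀ x t t′ p q s b → (x ℤ.+ t ℤ.* (p ℤ.* q) ℤ.+ q ℤ.* s) ℤ.- t′ ℤ.* (p ℤ.* q) ℤ.- b
                ≡ (x ℤ.- b) ℤ.+ (s ℤ.+ (t ℤ.- t′) ℤ.* p) ℤ.* q
      collect = ℤ-Solver.solve-∀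
    regroup : ∀ y s t t′ p → y ℤ.+ (s ℤ.+ (t ℤ.- t′) ℤ.* p) ≡ (y ℤ.+ s) ℤ.+ (t ℤ.- t′) ℤ.* p
    regroup = ℤ-Solver.solve-∀

module PrimeModulus {p : ℕ} (p-prime : Prime p) where
  open import Data.Bool using (Bool; true; false; not)
  open import Data.Nat using (_+_; _*_; _^_; _∸_; _≟_; _%_; _/_; NonZero; NonTrivial; nonTrivial⇒≢1; nonTrivial⇒n>1)
  import Data.Nat.Properties as ℕ
  open import Data.Nat.DivMod using (m≡m%n+[m/n]*n; [m+kn]%n≡m%n; [m+n]%n≡m%n; m%n%n≡m%n; m%n<n; m%n≤n; m<n⇒m%n≡m; %-distribˡ-+; %-distribˡ-*)
  open import Data.Nat.Divisibility using (_∣_; _∣?_; ∣-refl; ∣-trans; ∣⇒≤; ∣1⇒≡1; m%n≡0⇒n∣m; m∣m*n; n∣m*n; ∣m+n∣m⇒∣n; _∣0)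
  open import Data.Nat.GCD using (gcd; module Bézout)
  open import Data.Nat.Coprimality using (Coprime; gcd≡1⇒coprime; coprime⇒gcd≡1; coprime-divisor; coprime-Bézout)
  open import Data.Nat.Primality using (prime⇒nonZero; prime⇒nonTrivial; prime⇒irreducible; euclidsLemma)
  import Data.Nat.Tactic.RingSolver as ℕ-Solver
  open import Data.Product using (∃)
  open import Data.Sum using (inj₁; inj₂)
  open import Function using (_∘_; _⇔_; mk⇔; Equivalence)
  open import Relation.Nullary using (does; contradiction)
  open import Relation.Nullary.Decidable using (¬?; does-⇔; dec-true; dec-false)
  import Relation.Binary.PropositionalEquality as ≡
  open ≡ using (_≡_; refl; sym; trans; cong; cong₂; subst)
  open NatFacts
  open ℕ∑ using (∑; indicator)

  instance
    p≢0 : NonZero p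
    p≢0 = prime⇒nonZero p-prime
    p>1 : NonTrivial p
    p>1 = prime⇒nonTrivial p-prime

  p≢1 : p ≢ 1
  p≢1 = nonTrivial⇒≢1 {p}

  p∤1 : ¬ p ∣ 1
  p∤1 = p≢1 ∘ ∣1⇒≡1

  p∤-* : ∀ {a b} → ¬ p ∣ a → ¬ p ∣ b → ¬ p ∣ a * b
  p∤-* {a} {b} p∤a p∤b p∣ab with euclidsLemma a b p-prime p∣ab
  ... | inj₁ p∣a = p∤a p∣a
  ... | inj₂ p∣b = p∤b p∣b

  p∤-^ : ∀ {u} → ¬ p ∣ u → ∀ k → ¬ p ∣ u ^ k
  p∤-^ p∤u zero    = p∤1
  p∤-^ p∤u (suc k) = p∤-* p∤u (p∤-^ p∤u k)

  p∤⇒coprime : ∀ {u} → ¬ p ∣ u → Coprime u p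
  p∤⇒coprime p∤u (d∣u , d∣p) with prime⇒irreducible p-prime d∣p
  ... | inj₁ d≡1 = d≡1
  ... | inj₂ refl = contradiction d∣u p∤u

  p∤⇒coprime-^ : ∀ {u} → ¬ p ∣ u → ∀ k → Coprime u (p ^ k)
  p∤⇒coprime-^ p∤u zero    (_ , d∣1)       = ∣1⇒≡1 d∣1
  p∤⇒coprime-^ p∤u (suc k) (d∣u , d∣p^1+k) =
    p∤⇒coprime-^ p∤u k (d∣u , coprime-divisor d⊥p d∣p^1+k)
    where
    d⊥p : Coprime _ p
    d⊥p (e∣d , e∣p) = p∤⇒coprime p∤u (∣-trans e∣d d∣u , e∣p)

  gcd[u,p^1+k]≡1⇔p∤u : ∀ u k → gcd u (p ^ suc k) ≡ 1 ⇔ (¬ p ∣ u)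
  gcd[u,p^1+k]≡1⇔p∤u u k = mk⇔
    (λ gcd≡1 p∣u → p≢1 (gcd≡1⇒coprime gcd≡1 (p∣u , m∣m*n (p ^ k))))
    (λ p∤u → coprime⇒gcd≡1 (p∤⇒coprime-^ p∤u (suc k)))

  gcd[u,p]≡1⇔p∤u : ∀ u → gcd u p ≡ 1 ⇔ (¬ p ∣ u)
  gcd[u,p]≡1⇔p∤u u = subst (λ m → gcd u m ≡ 1 ⇔ (¬ p ∣ u)) (ℕ.*-identityʳ p) (gcd[u,p^1+k]≡1⇔p∤u u 0)

  coprimeᵇ : ℕ → Bool
  coprimeᵇ u = does (gcd u p ≟ 1)

  coprimeᵇ≡not[p∣?] : ∀ u → coprimeᵇ u ≡ not (does (p ∣? u))
  coprimeᵇ≡not[p∣?] u = does-⇔ (gcd[u,p]≡1⇔p∤u u) (gcd u p ≟ 1) (¬? (p ∣? u))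

  coprimeᵇ-periodic : ∀ k u → coprimeᵇ (k * p + u) ≡ coprimeᵇ u
  coprimeᵇ-periodic k u = begin
    coprimeᵇ (k * p + u)          ≡⟨ coprimeᵇ≡not[p∣?] (k * p + u) ⟩
    not (does (p ∣? (k * p + u))) ≡⟨ cong not (does-⇔ (∣[k*d+u]⇔∣u k p u) (p ∣? _) (p ∣? u)) ⟩
    not (does (p ∣? u))           ≡⟨ sym (coprimeᵇ≡not[p∣?] u) ⟩
    coprimeᵇ u                    ∎
    where open ≡.≡-Reasoning

  coprimeᵇ⇒p∤ : ∀ {u} → coprimeᵇ u ≡ true → ¬ p ∣ u
  coprimeᵇ⇒p∤ {u} eq = Equivalence.to (gcd[u,p]≡1⇔p∤u u) (does≡true⇒ (gcd u p ≟ 1) eq)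

  coprimeᵇ[0]≡false : coprimeᵇ 0 ≡ false
  coprimeᵇ[0]≡false = trans (coprimeᵇ≡not[p∣?] 0) (cong not (dec-true (p ∣? 0) (p ∣0)))

  coprimeᵇ[1+j]≡true : ∀ {j} → suc j < p → coprimeᵇ (suc j) ≡ true
  coprimeᵇ[1+j]≡true {j} j<p = trans (coprimeᵇ≡not[p∣?] (suc j)) (cong not (dec-false (p ∣? suc j) (ℕ.<⇒≱ j<p ∘ ∣⇒≤)))

  p∸1+1≡p : p ∸ 1 + 1 ≡ p
  p∸1+1≡p = ℕ.m∸n+n≡m (ℕ.<⇒≤ (nonTrivial⇒n>1 p))

  p≡1+[p∸1] : p ≡ suc (p ∸ 1)
  p≡1+[p∸1] = trans (sym p∸1+1≡p) (ℕ.+-comm (p ∸ 1) 1)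

  p∤p∸1 : ¬ p ∣ p ∸ 1
  p∤p∸1 p∣p∸1 = p∤1 (∣m+n∣m⇒∣n (subst (p ∣_) (sym p∸1+1≡p) ∣-refl) p∣p∸1)

  ∑-one-period-of-units : ∑ p (λ j → indicator (not (does (p ∣? suc j))) 1) ≡ p ∸ 1
  ∑-one-period-of-units = begin
    ∑ p c                                    ≡⟨ cong (λ m → ∑ m c) (sym p∸1+1≡p) ⟩
    ∑ (p ∸ 1 + 1) c                          ≡⟨ ℕ∑.∑-+ (p ∸ 1) 1 c ⟩
    ∑ (p ∸ 1) c + (c (p ∸ 1 + 0) + 0)        ≡⟨ cong₂ _+_ (ℕ∑.∑-cong< (p ∸ 1) unit) (cong (_+ 0) last) ⟩
    ∑ (p ∸ 1) (λ _ → 1) + 0                  ≡⟨ trans (ℕ.+-identityʳ _) (trans (∑-const (p ∸ 1) 1) (ℕ.*-identityʳ _)) ⟩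
    p ∸ 1                                    ∎
    where
    open ≡.≡-Reasoning
    c : ℕ → ℕ
    c j = indicator (not (does (p ∣? suc j))) 1
    unit : ∀ j → j < p ∸ 1 → c j ≡ 1
    unit j j<p∸1 = cong (λ β → indicator (not β) 1)
      (dec-false (p ∣? suc j) (ℕ.<⇒≱ (subst (suc j <_) (sym p≡1+[p∸1]) (s≤s j<p∸1)) ∘ ∣⇒≤))
    last : c (p ∸ 1 + 0) ≡ 0
    last = cong (λ β → indicator (not β) 1)
      (dec-true (p ∣? _) (subst (p ∣_) (trans p≡1+[p∸1] (cong suc (sym (ℕ.+-identityʳ _)))) ∣-refl))

  φ-p^1+k : ∀ k → φ (p ^ suc k) ≡ p ^ k * (p ∸ 1)
  φ-p^1+k k = begin
    φ (p ^ suc k)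
      ≡⟨ length-filter≡∑ (λ j → gcd j (p ^ suc k) ≟ 1) (λ i → i) (p ^ suc k) ⟩
    ∑ (p ^ suc k) (λ i → indicator (does (gcd (suc i) (p ^ suc k) ≟ 1)) 1)
      ≡⟨ ℕ∑.∑-cong (p ^ suc k) (λ i → cong (λ β → indicator β 1) (does-⇔ (gcd[u,p^1+k]≡1⇔p∤u (suc i) k) (gcd (suc i) (p ^ suc k) ≟ 1) (¬? (p ∣? suc i)))) ⟩
    ∑ (p * p ^ k) c
      ≡⟨ cong (λ m → ∑ m c) (ℕ.*-comm p (p ^ k)) ⟩
    ∑ (p ^ k * p) c
      ≡⟨ ℕ∑.∑-* (p ^ k) p c ⟩
    ∑ (p ^ k) (λ i → ∑ p (λ j → c (i * p + j)))
      ≡⟨ ℕ∑.∑-cong (p ^ k) (λ i → ℕ∑.∑-cong p (λ j → periodic i j)) ⟩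
    ∑ (p ^ k) (λ _ → ∑ p c)
      ≡⟨ ℕ∑.∑-cong (p ^ k) (λ _ → ∑-one-period-of-units) ⟩
    ∑ (p ^ k) (λ _ → p ∸ 1)
      ≡⟨ ∑-const (p ^ k) (p ∸ 1) ⟩
    p ^ k * (p ∸ 1) ∎
    where
    open ≡.≡-Reasoning
    c : ℕ → ℕ
    c j = indicator (not (does (p ∣? suc j))) 1
    periodic : ∀ i j → c (i * p + j) ≡ c j
    periodic i j = cong (λ β → indicator (not β) 1)
      (trans (cong (λ m → does (p ∣? m)) (sym (ℕ.+-suc (i * p) j))) (does-⇔ (∣[k*d+u]⇔∣u i p (suc j)) (p ∣? _) (p ∣? _)))

  prime≢2⇒odd : p ≢ 2 → p % 2 ≡ 1
  prime≢2⇒odd p≢2 with p % 2 in eq | m%n<n p 2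
  ... | 1 | _ = refl
  ... | suc (suc _) | s≤s (s≤s ())
  ... | 0 | _ with prime⇒irreducible p-prime (m%n≡0⇒n∣m p 2 eq)
  ...   | inj₁ ()
  ...   | inj₂ 2≡p = contradiction (sym 2≡p) p≢2

  infix 4 _≡ₚ_
  _≡ₚ_ : ℕ → ℕ → Set
  a ≡ₚ b = a % p ≡ b % p

  ≡ₚ-+ : ∀ {a a′ b b′} → a ≡ₚ a′ → b ≡ₚ b′ → a + b ≡ₚ a′ + b′
  ≡ₚ-+ {a} {a′} {b} {b′} a≡a′ b≡b′ =
    trans (%-distribˡ-+ a b p) (trans (cong₂ (λ x y → (x + y) % p) a≡a′ b≡b′) (sym (%-distribˡ-+ a′ b′ p)))

  ≡ₚ-* : ∀ {a a′ b b′} → a ≡ₚ a′ → b ≡ₚ b′ → a * b ≡ₚ a′ * b′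
  ≡ₚ-* {a} {a′} {b} {b′} a≡a′ b≡b′ =
    trans (%-distribˡ-* a b p) (trans (cong₂ (λ x y → (x * y) % p) a≡a′ b≡b′) (sym (%-distribˡ-* a′ b′ p)))

  +-cancel-≡ₚ : ∀ x y → x + y ≡ₚ x → p ∣ y
  +-cancel-≡ₚ x y x+y≡x = ∣m+n∣m⇒∣n (subst (p ∣_) shift (n∣m*n ((x + y) / p))) (n∣m*n (x / p))
    where
    shift : (x + y) / p * p ≡ x / p * p + y
    shift = ℕ.+-cancelˡ-≡ (x % p) _ _ (begin
      x % p + (x + y) / p * p         ≡⟨ cong (_+ (x + y) / p * p) (sym x+y≡x) ⟩
      (x + y) % p + (x + y) / p * p   ≡⟨ sym (m≡m%n+[m/n]*n (x + y) p) ⟩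
      x + y                           ≡⟨ cong (_+ y) (m≡m%n+[m/n]*n x p) ⟩
      x % p + x / p * p + y           ≡⟨ ℕ.+-assoc (x % p) _ y ⟩
      x % p + (x / p * p + y)         ∎)
      where open ≡.≡-Reasoning

  inverse-mod : ∀ {d} → ¬ p ∣ d → ∃ λ e → e * d ≡ₚ 1
  inverse-mod {d} p∤d with coprime-Bézout (p∤⇒coprime p∤d)
  ... | Bézout.+- x y 1+yp≡xd = x , trans (cong (_% p) (sym 1+yp≡xd)) ([m+kn]%n≡m%n 1 y p)
  ... | Bézout.-+ x y 1+xd≡yp = (p ∸ 1) * x , (begin
    (p ∸ 1) * x * d % p                   ≡⟨ sym ([m+n]%n≡m%n _ p) ⟩
    ((p ∸ 1) * x * d + p) % p             ≡⟨ cong (λ m → ((p ∸ 1) * x * d + m) % p) (sym p∸1+1≡p) ⟩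
    ((p ∸ 1) * x * d + (p ∸ 1 + 1)) % p   ≡⟨ cong (_% p) (regroup (p ∸ 1) x d) ⟩
    (1 + (p ∸ 1) * (1 + x * d)) % p       ≡⟨ cong (λ m → (1 + (p ∸ 1) * m) % p) 1+xd≡yp ⟩
    (1 + (p ∸ 1) * (y * p)) % p           ≡⟨ cong (λ m → (1 + m) % p) (sym (ℕ.*-assoc (p ∸ 1) y p)) ⟩
    (1 + (p ∸ 1) * y * p) % p             ≡⟨ [m+kn]%n≡m%n 1 ((p ∸ 1) * y) p ⟩
    1 % p                                 ∎)
    where
    open ≡.≡-Reasoning
    regroup : ∀ a x d → a * x * d + (a + 1) ≡ 1 + a * (1 + x * d)
    regroup = ℕ-Solver.solve-∀

  linear-congruence-solvable : ∀ h {d l} → ¬ p ∣ d → l < p → ∃ λ i → i < p × (h + i * d) % p ≡ l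
  linear-congruence-solvable h {d} {l} p∤d l<p with inverse-mod p∤d
  ... | e , ed≡1 = i , m%n<n (L * e) p , trans congruence (m<n⇒m%n≡m l<p)
    where
    L = l + (p ∸ h % p)
    i = L * e % p
    congruence : h + i * d ≡ₚ l
    congruence = begin
      (h + i * d) % p         ≡⟨ ≡ₚ-+ {h} refl (≡ₚ-* {i} (m%n%n≡m%n (L * e) p) refl) ⟩
      (h + L * e * d) % p     ≡⟨ cong (λ m → (h + m) % p) (ℕ.*-assoc L e d) ⟩
      (h + L * (e * d)) % p   ≡⟨ ≡ₚ-+ {h} (sym (m%n%n≡m%n h p)) (≡ₚ-* {L} refl ed≡1) ⟩
      (h % p + L * 1) % p     ≡⟨ cong (_% p) (trans (cong (h % p +_) (ℕ.*-identityʳ L)) (reorder (h % p) l (p ∸ h % p))) ⟩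
      (l + (p ∸ h % p + h % p)) % p ≡⟨ cong (λ m → (l + m) % p) (ℕ.m∸n+n≡m (m%n≤n h p)) ⟩
      (l + p) % p             ≡⟨ [m+n]%n≡m%n l p ⟩
      l % p                   ∎
      where
      open ≡.≡-Reasoning
      reorder : ∀ a l x → a + (l + x) ≡ l + (x + a)
      reorder = ℕ-Solver.solve-∀

  linear-congruence-unique≤ : ∀ h {d i j} → ¬ p ∣ d → j < p → h + i * d ≡ₚ h + j * d → i ≤ j → i ≡ j
  linear-congruence-unique≤ h {d} {i} {j} p∤d j<p eq i≤j with j ∸ i in j∸i≡k
  ... | zero  = ℕ.≤-antisym i≤j (ℕ.m∸n≡0⇒m≤n j∸i≡k)
  ... | suc k = contradiction p∣1+k (ℕ.<⇒≱ (ℕ.≤-<-trans (subst (_≤ j) j∸i≡k (ℕ.m∸n≤m j i)) j<p) ∘ ∣⇒≤)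
    where
    j≡i+1+k : j ≡ i + suc k
    j≡i+1+k = trans (sym (ℕ.m+[n∸m]≡n i≤j)) (cong (i +_) j∸i≡k)
    distrib : ∀ h i k d → h + (i + k) * d ≡ h + i * d + k * d
    distrib = ℕ-Solver.solve-∀
    p∣1+k : p ∣ suc k
    p∣1+k with euclidsLemma (suc k) d p-prime
                 (+-cancel-≡ₚ (h + i * d) (suc k * d)
                   (trans (cong (_% p) (sym (trans (cong (λ m → h + m * d) j≡i+1+k) (distrib h i (suc k) d)))) (sym eq)))
    ... | inj₁ p∣1+k = p∣1+k
    ... | inj₂ p∣d   = contradiction p∣d p∤d

  linear-congruence-unique : ∀ h {d i j} → ¬ p ∣ d → i < p → j < p → h + i * d ≡ₚ h + j * d → i ≡ j
  linear-congruence-unique h p∤d i<p j<p eq with ℕ.≤-total _ _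
  ... | inj₁ i≤j = linear-congruence-unique≤ h p∤d j<p eq i≤j
  ... | inj₂ j≤i = sym (linear-congruence-unique≤ h p∤d i<p (sym eq) j≤i)

module QuotientShift {p : ℕ} (p-prime : Prime p) (s : ℕ) where
  open import Data.Bool using (true; if_then_else_)
  open import Data.Nat using (_+_; _*_; _^_; _∸_; _%_; NonZero)
  import Data.Nat.Properties as ℕ
  open import Data.Nat.DivMod using ([m+kn]%n≡m%n)
  open import Data.Nat.Divisibility using (_∣_)
  import Data.Integer as ℤ
  import Data.Nat.Tactic.RingSolver as ℕ-Solver
  open import Data.Product using (∃)
  open import Relation.Nullary using (contradiction)
  import Relation.Binary.PropositionalEquality as ≡
  open ≡ using (_≡_; sym; trans; cong; cong₂)
  open NatFacts
  open IntegerDivision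
  open PrimeModulus p-prime

  r q P n m : ℕ
  r = suc (suc s)
  q = p ^ suc s
  P = p * q
  n = φ P
  m = φ q

  instance
    q≢0 : NonZero q
    q≢0 = ℕ.m^n≢0 p (suc s)
    P≢0 : NonZero P
    P≢0 = ℕ.m*n≢0 p q

  slope : ℕ → ℕ
  slope u = (p ∸ 1) * u ^ (n ∸ 1)

  p∤slope : ∀ {u} → coprimeᵇ u ≡ true → ¬ p ∣ slope u
  p∤slope u-unit = p∤-* p∤p∸1 (p∤-^ (coprimeᵇ⇒p∤ u-unit) (n ∸ 1))

  coprimeᵇ-shift : ∀ i u → coprimeᵇ (i * P + u) ≡ coprimeᵇ u
  coprimeᵇ-shift i u = trans (cong (λ x → coprimeᵇ (x + u)) (reassoc i p q)) (coprimeᵇ-periodic (i * q) u)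
    where
    reassoc : ∀ i p q → i * (p * q) ≡ i * q * p
    reassoc = ℕ-Solver.solve-∀

  1≤u^k : ∀ {u} → coprimeᵇ u ≡ true → ∀ k → 1 ≤ u ^ k
  1≤u^k {zero}  u-unit k = contradiction (trans (sym coprimeᵇ[0]≡false) u-unit) λ ()
  1≤u^k {suc u} u-unit k = ℕ.m^n>0 (suc u) k

  Q-coprime : ∀ k {u} → coprimeᵇ u ≡ true → Q p k u ≡ modN (divN (u ^ φ (p ^ k) ∸ 1) (p ^ k)) (p ^ k)
  Q-coprime k {u} u-unit = cong (λ β → if β then modN (divN (u ^ φ (p ^ k) ∸ 1) (p ^ k)) (p ^ k) else 0) u-unit

  H-coprime : ∀ {u} → coprimeᵇ u ≡ true → H p r u ≡ digit p q (Q p (suc s) u) (divN (u ^ n ∸ 1) P)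
  H-coprime {u} u-unit =
    cong (λ x → modZ (divZ (ℤ.+ x ℤ.- ℤ.+ Q p (suc s) u) q) p) (Q-coprime r u-unit)

  pow-φ[P]-shift : ∀ i u → ∃ λ E → (i * P + u) ^ n ≡ u ^ n + P * (q * (i * slope u + p * E))
  pow-φ[P]-shift i u with binomial-truncated (i * P) u n
  ... | R , expansion = i * i * R , (begin
    (i * P + u) ^ n                                                        ≡⟨ expansion ⟩
    u ^ n + n * (i * P) * u ^ (n ∸ 1) + i * P * (i * P) * R               ≡⟨ cong (λ k → u ^ n + k * (i * P) * u ^ (n ∸ 1) + i * P * (i * P) * R) (φ-p^1+k (suc s)) ⟩
    u ^ n + q * (p ∸ 1) * (i * P) * u ^ (n ∸ 1) + i * P * (i * P) * R     ≡⟨ regroup (u ^ n) p q (p ∸ 1) i (u ^ (n ∸ 1)) R ⟩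
    u ^ n + P * (q * (i * slope u + p * (i * i * R)))                      ∎)
    where
    open ≡.≡-Reasoning
    regroup : ∀ a p q p′ i U R → a + q * p′ * (i * (p * q)) * U + i * (p * q) * (i * (p * q)) * R
              ≡ a + p * q * (q * (i * (p′ * U) + p * (i * i * R)))
    regroup = ℕ-Solver.solve-∀

  pow-φ[q]-shift : ∀ i u → ∃ λ W → (i * P + u) ^ m ≡ u ^ m + q * (q * W)
  pow-φ[q]-shift i u with binomial-truncated (i * P) u m
  ... | R , expansion = (p ∸ 1) * i * u ^ (m ∸ 1) + i * i * p * p * R , (begin
    (i * P + u) ^ m                                                        ≡⟨ expansion ⟩
    u ^ m + m * (i * P) * u ^ (m ∸ 1) + i * P * (i * P) * R               ≡⟨ cong (λ k → u ^ m + k * (i * P) * u ^ (m ∸ 1) + i * P * (i * P) * R) (φ-p^1+k s) ⟩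
    u ^ m + p ^ s * (p ∸ 1) * (i * P) * u ^ (m ∸ 1) + i * P * (i * P) * R ≡⟨ regroup (u ^ m) p (p ^ s) (p ∸ 1) i (u ^ (m ∸ 1)) R ⟩
    u ^ m + q * (q * ((p ∸ 1) * i * u ^ (m ∸ 1) + i * i * p * p * R))     ∎)
    where
    open ≡.≡-Reasoning
    regroup : ∀ a p t p′ i U R → a + t * p′ * (i * (p * (p * t))) * U + i * (p * (p * t)) * (i * (p * (p * t))) * R
              ≡ a + p * t * (p * t * (p′ * i * U + i * i * p * p * R))
    regroup = ℕ-Solver.solve-∀

  Q[r-1]-shift : ∀ i {u} → coprimeᵇ u ≡ true → Q p (suc s) (i * P + u) ≡ Q p (suc s) u
  Q[r-1]-shift i {u} u-unit with pow-φ[q]-shift i u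
  ... | W , shift = begin
    Q p (suc s) (i * P + u)                                ≡⟨ Q-coprime (suc s) (trans (coprimeᵇ-shift i u) u-unit) ⟩
    modN (divN ((i * P + u) ^ m ∸ 1) q) q                  ≡⟨ cong (λ x → modN (divN (x ∸ 1) q) q) shift ⟩
    modN (divN (u ^ m + q * (q * W) ∸ 1) q) q              ≡⟨ cong (λ x → modN x q) (divN-pred-+-* (u ^ m) q (q * W) (1≤u^k u-unit m)) ⟩
    modN (divN (u ^ m ∸ 1) q + q * W) q                    ≡⟨ modN-+-* (divN (u ^ m ∸ 1) q) q W ⟩
    modN (divN (u ^ m ∸ 1) q) q                            ≡⟨ sym (Q-coprime (suc s) u-unit) ⟩
    Q p (suc s) u                                          ∎
    where open ≡.≡-Reasoning

  H-shift : ∀ i {u} → coprimeᵇ u ≡ true → H p r (i * P + u) ≡ (H p r u + i * slope u) % p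
  H-shift i {u} u-unit with pow-φ[P]-shift i u
  ... | E , shift = begin
    H p r (i * P + u)                               ≡⟨ H-coprime {i * P + u} (trans (coprimeᵇ-shift i u) u-unit) ⟩
    digit p q (Q p (suc s) (i * P + u)) (divN ((i * P + u) ^ n ∸ 1) P)
      ≡⟨ cong₂ (digit p q) (Q[r-1]-shift i u-unit) (cong (λ x → divN (x ∸ 1) P) shift) ⟩
    digit p q b (divN (u ^ n + P * (q * S) ∸ 1) P)            ≡⟨ cong (digit p q b) (divN-pred-+-* (u ^ n) P (q * S) (1≤u^k u-unit n)) ⟩
    digit p q b (divN (u ^ n ∸ 1) P + q * S)                  ≡⟨ digit-+-* p q b _ S ⟩
    (digit p q b (divN (u ^ n ∸ 1) P) + S) % p                ≡⟨ cong (λ h → (h + S) % p) (sym (H-coprime {u} u-unit)) ⟩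
    (H p r u + (i * slope u + p * E)) % p         ≡⟨ cong (_% p) (regroup (H p r u) (i * slope u) p E) ⟩
    (H p r u + i * slope u + E * p) % p           ≡⟨ [m+kn]%n≡m%n _ E p ⟩
    (H p r u + i * slope u) % p                   ∎
    where
    open ≡.≡-Reasoning
    b = Q p (suc s) u
    S = i * slope u + p * E
    regroup : ∀ h x p E → h + (x + p * E) ≡ h + x + E * p
    regroup = ℕ-Solver.solve-∀

module SemiringSum {a ℓ} (S : Semiring a ℓ) where
  import Data.Nat as ℕ
  import Data.Nat.Properties as ℕ
  open import Function using (_∘_)
  import Relation.Binary.PropositionalEquality as ≡
  open Semiring S
  open import Algebra.Definitions.RawSemiring rawSemiring using (_^_)
  open FiniteSum +-commutativeMonoid
  open import Relation.Binary.Reasoning.Setoid setoid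

  *-distribˡ-∑ : ∀ n k (f : ℕ → Carrier) → k * ∑ n f ≈ ∑ n (λ i → k * f i)
  *-distribˡ-∑ zero    k f = zeroʳ k
  *-distribˡ-∑ (suc n) k f = trans (distribˡ k _ _) (+-congˡ (*-distribˡ-∑ n k (f ∘ suc)))

  geometric-sum : ∀ θ n → 1# + θ * ∑ n (θ ^_) ≈ ∑ n (θ ^_) + θ ^ n
  geometric-sum θ n = begin
    1# + θ * ∑ n (θ ^_)              ≈⟨ +-congˡ (*-distribˡ-∑ n θ (θ ^_)) ⟩
    ∑ (suc n) (θ ^_)                 ≈⟨ ∑-length (θ ^_) (ℕ.+-comm 1 n) ⟩
    ∑ (n ℕ.+ 1) (θ ^_)               ≈⟨ ∑-+ n 1 (θ ^_) ⟩
    ∑ n (θ ^_) + (θ ^ (n ℕ.+ 0) + 0#) ≈⟨ +-congˡ (trans (+-identityʳ _) (reflexive (≡.cong (θ ^_) (ℕ.+-identityʳ n)))) ⟩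
    ∑ n (θ ^_) + θ ^ n               ∎

  1^n≈1 : ∀ n → 1# ^ n ≈ 1#
  1^n≈1 zero    = refl
  1^n≈1 (suc n) = trans (*-identityˡ _) (1^n≈1 n)

module Characteristic2 {c ℓ} (F : Char2Field c ℓ) where
  open import Data.Nat using (_%_)
  import Data.Nat.Properties as ℕ
  open import Data.Nat.DivMod using ([m+n]%n≡m%n)
  open import Function using (_∘_)
  import Relation.Binary.PropositionalEquality as ≡
  open ≡ using (_≡_)
  open Char2Field F
  open FiniteSum +-commutativeMonoid public
  open SemiringSum semiring public
  open import Algebra.Properties.Group +-group using (∙-cancelˡ)
  open import Relation.Binary.Reasoning.Setoid setoid

  x+x≈0 : ∀ x → x + x ≈ 0#
  x+x≈0 x = begin
    x + x             ≈⟨ +-cong (sym (*-identityˡ x)) (sym (*-identityˡ x)) ⟩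
    1# * x + 1# * x   ≈⟨ sym (distribʳ x 1# 1#) ⟩
    (1# + 1#) * x     ≈⟨ *-congʳ char2 ⟩
    0# * x            ≈⟨ zeroˡ x ⟩
    0#                ∎

  x+y≈0⇒x≈y : ∀ {x y} → x + y ≈ 0# → x ≈ y
  x+y≈0⇒x≈y {x} {y} x+y≈0 = begin
    x               ≈⟨ sym (+-identityʳ x) ⟩
    x + 0#          ≈⟨ +-congˡ (sym (x+x≈0 y)) ⟩
    x + (y + y)     ≈⟨ sym (+-assoc x y y) ⟩
    (x + y) + y     ≈⟨ +-congʳ x+y≈0 ⟩
    0# + y          ≈⟨ +-identityˡ y ⟩
    y               ∎

  ∑-const-parity : ∀ n x → ∑ n (λ _ → x) ≈ ∑ (n % 2) (λ _ → x)
  ∑-const-parity zero          x = refl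
  ∑-const-parity (suc zero)    x = refl
  ∑-const-parity (suc (suc n)) x = begin
    x + (x + ∑ n (λ _ → x))   ≈⟨ sym (+-assoc x x _) ⟩
    (x + x) + ∑ n (λ _ → x)   ≈⟨ +-congʳ (x+x≈0 x) ⟩
    0# + ∑ n (λ _ → x)        ≈⟨ +-identityˡ _ ⟩
    ∑ n (λ _ → x)             ≈⟨ ∑-const-parity n x ⟩
    ∑ (n % 2) (λ _ → x)       ≈⟨ ∑-length _ (≡.trans (≡.sym ([m+n]%n≡m%n n 2)) (≡.cong (_% 2) (ℕ.+-comm n 2))) ⟩
    ∑ (suc (suc n) % 2) (λ _ → x) ∎

  ∑-const-odd : ∀ {n} x → n % 2 ≡ 1 → ∑ n (λ _ → x) ≈ x
  ∑-const-odd {n} x odd = trans (∑-const-parity n x) (trans (∑-length _ odd) (+-identityʳ x))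

  nonzero-*-cancel : ∀ {x y} → ¬ x ≈ 0# → x * y ≈ 0# → y ≈ 0#
  nonzero-*-cancel {x} {y} x≉0 xy≈0 with inverse x x≉0
  ... | x⁻¹ , xx⁻¹≈1 = begin
    y                ≈⟨ sym (*-identityˡ y) ⟩
    1# * y           ≈⟨ *-congʳ (trans (sym xx⁻¹≈1) (*-comm x x⁻¹)) ⟩
    (x⁻¹ * x) * y    ≈⟨ *-assoc x⁻¹ x y ⟩
    x⁻¹ * (x * y)    ≈⟨ *-congˡ xy≈0 ⟩
    x⁻¹ * 0#         ≈⟨ zeroʳ x⁻¹ ⟩
    0#               ∎

  ∑-root-of-unity : ∀ {θ n} → pow F θ n ≈ 1# → ¬ θ ≈ 1# → ∑ n (pow F θ) ≈ 0#
  ∑-root-of-unity {θ} {n} θⁿ≈1 θ≉1 = nonzero-*-cancel θ+1≉0 (begin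
    (θ + 1#) * G       ≈⟨ distribʳ G θ 1# ⟩
    θ * G + 1# * G     ≈⟨ +-cong θG≈G (*-identityˡ G) ⟩
    G + G              ≈⟨ x+x≈0 G ⟩
    0#                 ∎)
    where
    G = ∑ n (pow F θ)
    θ+1≉0 : ¬ θ + 1# ≈ 0#
    θ+1≉0 = θ≉1 ∘ x+y≈0⇒x≈y
    θG≈G : θ * G ≈ G
    θG≈G = ∙-cancelˡ 1# _ _ (begin
      1# + θ * G         ≈⟨ geometric-sum θ n ⟩
      G + pow F θ n      ≈⟨ +-congˡ θⁿ≈1 ⟩
      G + 1#             ≈⟨ +-comm G 1# ⟩
      1# + G             ∎)

module Evaluation {c ℓ} (F : Char2Field c ℓ) {p : ℕ} (p-prime : Prime p) (p≢2 : p ≢ 2) (s : ℕ)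
                  (θ : Char2Field.Carrier F) (θ^p≈1 : Char2Field._≈_ F (pow F θ p) (Char2Field.1# F))
                  {l : ℕ} (l<p : l < p) where
  open import Data.Bool using (Bool; true; false; _∧_)
  import Data.Nat as ℕ
  open import Data.Nat using (_≟_; _%_)
  import Data.Nat.Properties as ℕ
  open import Data.Product using (proj₁; proj₂)
  open import Function using (_∘_)
  open import Relation.Nullary using (does)
  open import Relation.Nullary.Decidable using (dec-true)
  import Relation.Binary.PropositionalEquality as ≡
  open ≡ using (_≡_; cong; cong₂)
  open NatFacts using (odd-^; does≡true⇒)
  open Char2Field F
  open Characteristic2 F
  open PrimeModulus p-prime
  open QuotientShift p-prime s
  import Algebra.Properties.Semiring.Exp semiring as Exp
  open import Relation.Binary.Reasoning.Setoid setoid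

  θ^-periodic : ∀ k j → pow F θ (k ℕ.* p ℕ.+ j) ≈ pow F θ j
  θ^-periodic k j = begin
    pow F θ (k ℕ.* p ℕ.+ j)                 ≈⟨ Exp.^-homo-* θ (k ℕ.* p) j ⟩
    pow F θ (k ℕ.* p) * pow F θ j          ≈⟨ *-congʳ (Exp.^-congʳ θ (ℕ.*-comm k p)) ⟩
    pow F θ (p ℕ.* k) * pow F θ j          ≈⟨ *-congʳ (sym (Exp.^-assocʳ θ p k)) ⟩
    pow F (pow F θ p) k * pow F θ j        ≈⟨ *-congʳ (trans (Exp.^-congˡ k θ^p≈1) (1^n≈1 k)) ⟩
    1# * pow F θ j                         ≈⟨ *-identityˡ _ ⟩
    pow F θ j                              ∎

  term : ℕ → Carrier
  term u = indicator (coprimeᵇ u ∧ does (H p r u ≟ l)) (pow F θ u)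

  unitPower : ℕ → Carrier
  unitPower j = indicator (coprimeᵇ j) (pow F θ j)

  Dl≈∑ : Dl F p r l θ ≈ ∑ (p ℕ.* P) term
  Dl≈∑ = foldr-select≈∑ (λ u → coprimeᵇ u ∧ does (H p r u ≟ l)) (pow F θ) (λ u → u) (p ℕ.* P)

  ∑-fibre : ∀ j → ∑ p (λ i → term (i ℕ.* P ℕ.+ j)) ≈ indicator (coprimeᵇ j) (pow F θ j)
  ∑-fibre j with coprimeᵇ j in j-unit
  ... | false = ∑-indicator-none p (λ i → coprimeᵇ (i ℕ.* P ℕ.+ j) ∧ does (H p r (i ℕ.* P ℕ.+ j) ≟ l)) (λ i → pow F θ (i ℕ.* P ℕ.+ j))
                (λ i _ → cong (_∧ does (H p r (i ℕ.* P ℕ.+ j) ≟ l)) (≡.trans (coprimeᵇ-shift i j) j-unit))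
  ... | true  = trans (∑-cong p on-fibre) (∑-indicator-unique p hit (pow F θ j) i₀<p (dec-true (_ ≟ l) i₀-hits-l) unique)
    where
    hit : ℕ → Bool
    hit i = does ((H p r j ℕ.+ i ℕ.* slope j) % p ≟ l)
    on-fibre : ∀ i → term (i ℕ.* P ℕ.+ j) ≈ indicator (hit i) (pow F θ j)
    on-fibre i = indicator-cong (cong₂ _∧_ (≡.trans (coprimeᵇ-shift i j) j-unit) (cong (λ h → does (h ≟ l)) (H-shift i j-unit)))
                                (trans (Exp.^-congʳ θ (cong (ℕ._+ j) (reassoc i))) (θ^-periodic (i ℕ.* q) j))
      where
      reassoc : ∀ i → i ℕ.* P ≡ i ℕ.* q ℕ.* p
      reassoc i = ≡.trans (cong (i ℕ.*_) (ℕ.*-comm p q)) (≡.sym (ℕ.*-assoc i q p))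
    solution = linear-congruence-solvable (H p r j) (p∤slope j-unit) l<p
    i₀ = proj₁ solution
    i₀<p = proj₁ (proj₂ solution)
    i₀-hits-l = proj₂ (proj₂ solution)
    unique : ∀ i → i < p → hit i ≡ true → i ≡ i₀
    unique i i<p hit-i = linear-congruence-unique (H p r j) (p∤slope j-unit) i<p i₀<p
      (≡.trans (does≡true⇒ (_ ≟ l) hit-i) (≡.sym i₀-hits-l))

  ∑-units-over-P : ∑ P unitPower ≈ ∑ p unitPower
  ∑-units-over-P = begin
    ∑ P unitPower                                          ≈⟨ ∑-length unitPower (ℕ.*-comm p q) ⟩
    ∑ (q ℕ.* p) unitPower                                  ≈⟨ ∑-* q p unitPower ⟩
    ∑ q (λ k → ∑ p (λ j → unitPower (k ℕ.* p ℕ.+ j)))       ≈⟨ ∑-cong q (λ k → ∑-cong p (periodic k)) ⟩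
    ∑ q (λ _ → ∑ p unitPower)                              ≈⟨ ∑-const-odd {q} _ (odd-^ {p} (prime≢2⇒odd p≢2) (suc s)) ⟩
    ∑ p unitPower                                          ∎
    where
    periodic : ∀ k j → unitPower (k ℕ.* p ℕ.+ j) ≈ unitPower j
    periodic k j = indicator-cong (coprimeᵇ-periodic k j) (θ^-periodic k j)

  Dl≈∑-units : Dl F p r l θ ≈ ∑ p unitPower
  Dl≈∑-units = begin
    Dl F p r l θ                                           ≈⟨ Dl≈∑ ⟩
    ∑ (p ℕ.* P) term                                       ≈⟨ ∑-* p P term ⟩
    ∑ p (λ i → ∑ P (λ j → term (i ℕ.* P ℕ.+ j)))           ≈⟨ ∑-comm p P _ ⟩
    ∑ P (λ j → ∑ p (λ i → term (i ℕ.* P ℕ.+ j)))           ≈⟨ ∑-cong P ∑-fibre ⟩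
    ∑ P unitPower                                          ≈⟨ ∑-units-over-P ⟩
    ∑ p unitPower                                          ∎

  1+∑-units≈∑-powers : 1# + ∑ p unitPower ≈ ∑ p (pow F θ)
  1+∑-units≈∑-powers = begin
    1# + ∑ p unitPower                                     ≈⟨ +-congˡ (∑-length unitPower p≡1+[p∸1]) ⟩
    1# + (unitPower 0 + ∑ (p ℕ.∸ 1) (unitPower ∘ suc))     ≈⟨ +-congˡ (+-cong (indicator-cong coprimeᵇ[0]≡false refl) (∑-cong< (p ℕ.∸ 1) units)) ⟩
    1# + (0# + ∑ (p ℕ.∸ 1) (pow F θ ∘ suc))                ≈⟨ +-congˡ (+-identityˡ _) ⟩
    ∑ (suc (p ℕ.∸ 1)) (pow F θ)                            ≈⟨ ∑-length (pow F θ) (≡.sym p≡1+[p∸1]) ⟩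
    ∑ p (pow F θ)                                          ∎
    where
    units : ∀ j → j < p ℕ.∸ 1 → unitPower (suc j) ≈ pow F θ (suc j)
    units j j<p∸1 = indicator-cong (coprimeᵇ[1+j]≡true (≡.subst (suc j <_) (≡.sym p≡1+[p∸1]) (s≤s j<p∸1))) refl

  1+Dl≈∑-powers : 1# + Dl F p r l θ ≈ ∑ p (pow F θ)
  1+Dl≈∑-powers = trans (+-congˡ Dl≈∑-units) 1+∑-units≈∑-powers

lemma3 : ∀ {c ℓ} (F : Char2Field c ℓ) (p r : ℕ) → Prime p → p ≢ 2 → 2 ≤ r →
         (θ : Char2Field.Carrier F) →
         Char2Field._≈_ F (pow F θ p) (Char2Field.1# F) →
         ∀ l → l < p →
         (Char2Field._≈_ F θ (Char2Field.1# F) → Char2Field._≈_ F (Dl F p r l θ) (Char2Field.0# F)) ×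
         (¬ Char2Field._≈_ F θ (Char2Field.1# F) → Char2Field._≈_ F (Dl F p r l θ) (Char2Field.1# F))
lemma3 F p (suc zero)         _       _   (s≤s ()) _ _ _ _
lemma3 F p r@(suc (suc s)) p-prime p≢2 _ θ θ^p≈1 l l<p = vanishes-at-1 , equals-1-elsewhere
  where
  open Char2Field F
  open Characteristic2 F
  open Evaluation F p-prime p≢2 s θ θ^p≈1 l<p
  import Algebra.Properties.Semiring.Exp semiring as Exp
  open import Algebra.Properties.Group +-group using (∙-cancelˡ)

  vanishes-at-1 : θ ≈ 1# → Dl F p r l θ ≈ 0#
  vanishes-at-1 θ≈1 = ∙-cancelˡ 1# _ _ (trans 1+Dl≈∑-powers (trans sum≈1 (sym (+-identityʳ 1#))))
    where
    sum≈1 : ∑ p (pow F θ) ≈ 1#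
    sum≈1 = trans (∑-cong p (λ k → trans (Exp.^-congˡ k θ≈1) (1^n≈1 k)))
                  (∑-const-odd {p} 1# (PrimeModulus.prime≢2⇒odd p-prime p≢2))

  equals-1-elsewhere : ¬ θ ≈ 1# → Dl F p r l θ ≈ 1#
  equals-1-elsewhere θ≉1 = sym (x+y≈0⇒x≈y (trans 1+Dl≈∑-powers (∑-root-of-unity {θ} {p} θ^p≈1 θ≉1)))
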